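{- For $0\le n\le N$, the sum of the weights of the elements of $\mathfrak R_{N,n}$ equals \[ R_{N,n}(y,q)=\sum_{i=0}^{\lfloor (N-n)/2\rfloor}(-y)^i q^{\binom{i+1}{2}}\begin{bmatrix} n+i\\ i\end{bmatrix}_q\sum_{j=0}^{N-n-2i}y^j\left(\binom{N}{j}\binom{N}{n+2i+j}-\binom{N}{j-1}\binom{N}{n+2i+j+1}\right). \]
   Context: $\mathfrak R_{N,n}$ is the set of weighted Motzkin paths of length $N$ (paths with steps $\nearrow,\rightarrow,\searrow$ from height 0 to height 0 never going below 0, each step carrying one of its allowed weights; different weight choices give different elements) such that: a step $\nearrow$ starting at height $h$ has weight $1$ or $-q^{h+1}$; a step $\rightarrow$ starting at height $h$ has weight $1+y$ or $q^h$; a step $\searrow$ has weight $y$; and exactly $n$ steps $\rightarrow$ have the weight $q^h$ (a power of $q$). The weight of a path is the product of its step weights. $\begin{bmatrix} n\\ k\end{bmatrix}_q$ is the Gaussian binomial; binomial coefficients with negative lower index are $0$. -}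

module Defs where

open import Data.Nat as ℕ using (ℕ; zero; suc; _∸_; _/_; _≡ᵇ_)
open import Data.Nat.Combinatorics using (_C_)
open import Data.Integer using (ℤ; +_; _+_; _-_; _*_; -_; _^_; 0ℤ; 1ℤ)
open import Data.Bool using (Bool; true; false; _∧_; if_then_else_)
open import Data.List using (List; []; _∷_; map; concatMap; upTo)
import Data.List as L

-- A step together with its chosen weight:
--   upOne   : ↗ with weight 1
--   upQ     : ↗ with weight -q^(h+1)   (h = starting height)
--   flatOneY: → with weight 1+y
--   flatQ   : → with weight q^h        (h = starting height)
--   down    : ↘ with weight y

data Step : Set where
  upOne upQ flatOneY flatQ down : Step

allSteps : List Step
allSteps = upOne ∷ upQ ∷ flatOneY ∷ flatQ ∷ down ∷ []

words : ℕ → List (List Step)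
words zero    = [] ∷ []
words (suc N) = concatMap (λ s → map (s ∷_) (words N)) allSteps

isMotzkinFrom : ℕ → List Step → Bool
isMotzkinFrom zero    []              = true
isMotzkinFrom (suc h) []              = false
isMotzkinFrom h       (upOne ∷ s)     = isMotzkinFrom (suc h) s
isMotzkinFrom h       (upQ ∷ s)       = isMotzkinFrom (suc h) s
isMotzkinFrom h       (flatOneY ∷ s)  = isMotzkinFrom h s
isMotzkinFrom h       (flatQ ∷ s)     = isMotzkinFrom h s
isMotzkinFrom zero    (down ∷ s)      = false
isMotzkinFrom (suc h) (down ∷ s)      = isMotzkinFrom h s

countFlatQ : List Step → ℕ
countFlatQ []            = 0
countFlatQ (flatQ ∷ s)   = suc (countFlatQ s)
countFlatQ (_ ∷ s)       = countFlatQ s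

inR : ℕ → List Step → Bool
inR n p = isMotzkinFrom 0 p ∧ (countFlatQ p ≡ᵇ n)

weightFrom : ℤ → ℤ → ℕ → List Step → ℤ
weightFrom y q h       []             = 1ℤ
weightFrom y q h       (upOne ∷ s)    = weightFrom y q (suc h) s
weightFrom y q h       (upQ ∷ s)      = (- (q ^ suc h)) * weightFrom y q (suc h) s
weightFrom y q h       (flatOneY ∷ s) = (1ℤ + y) * weightFrom y q h s
weightFrom y q h       (flatQ ∷ s)    = (q ^ h) * weightFrom y q h s
weightFrom y q h       (down ∷ s)     = y * weightFrom y q (h ∸ 1) s

sumℤ : List ℤ → ℤ
sumℤ = L.foldr _+_ 0ℤ

weightSumR : ℕ → ℕ → ℤ → ℤ → ℤ
weightSumR N n y q =
  sumℤ (map (λ p → if inR n p then weightFrom y q 0 p else 0ℤ) (words N))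

sumTo : ℕ → (ℕ → ℤ) → ℤ
sumTo m f = sumℤ (map f (upTo (suc m)))

gauss : ℤ → ℕ → ℕ → ℤ
gauss q n       zero    = 1ℤ
gauss q zero    (suc k) = 0ℤ
gauss q (suc n) (suc k) = gauss q n k + (q ^ suc k) * gauss q n (suc k)

-- integer binomial coefficient (zero when k > n)
binZ : ℕ → ℕ → ℤ
binZ n k = + (n C k)

-- binom(n, j-1), zero when j - 1 < 0
binZpred : ℕ → ℕ → ℤ
binZpred n zero    = 0ℤ
binZpred n (suc j) = binZ n j

RNn : ℕ → ℕ → ℤ → ℤ → ℤ
RNn N n y q =
  sumTo ((N ∸ n) / 2) λ i →
    ((- y) ^ i) * (q ^ (suc i C 2)) * gauss q (n ℕ.+ i) i *
    sumTo (N ∸ n ∸ 2 ℕ.* i) λ j →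
      (y ^ j) * (binZ N j * binZ N (n ℕ.+ 2 ℕ.* i ℕ.+ j)
                 - binZpred N j * binZ N (n ℕ.+ 2 ℕ.* i ℕ.+ j ℕ.+ 1))

module Submission where

-- Let S N h n be the weighted sum over paths of length N that start at height h, end at height 0
-- and carry n flat steps of weight q^height; the proposition is the case h = 0. Splitting off
-- the first step expresses S (N + 1) linearly through S N. The closed form
--   Σᵢ y^h (−y)^i q^(i+1 choose 2) [h+i+n; h, i, n]_q T N (h + n + 2i),
--   T N m = Σⱼ y^j (C(N, j) C(N, m + j) − C(N, j − 1) C(N, m + j + 1)),
-- satisfies the same recursion and the same initial values. For T this is the three-term rule
-- T (N + 1) m = T N (m − 1) + (1 + y) T N m + y T N (m + 1), a consequence of Pascal's rule;
-- for the coefficients it is a three-term identity that follows from the q-Pascal rules and the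
-- absorption identity (1 − q^(a+1)) [a+b+1, a+1]_q = (1 − q^(a+b+1)) [a+b, a]_q.

open import Defs
open import Data.Nat using (ℕ; _≤_)
open import Data.Integer using (ℤ)
open import Relation.Binary.PropositionalEquality using (_≡_)

open import Data.Nat as ℕ using (zero; suc; _∸_; _<_; _<?_; z≤n; s≤s; _/_; _≡ᵇ_)
import Data.Nat.Properties as ℕP
open import Data.Nat.Combinatorics using (_C_; k>n⇒nCk≡0; nCk+nC[k+1]≡[n+1]C[k+1]; nC1≡n)
open import Data.Nat.DivMod using (m/n≤m; m*n/n≡m; /-monoˡ-≤)
open import Data.Integer using (+_; _+_; _-_; _*_; -_; _^_; 0ℤ; 1ℤ)
import Data.Integer.Properties as ℤP
open import Data.Integer.Tactic.RingSolver using (solve-∀)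
open import Data.Bool using (true; false; _∧_; if_then_else_)
open import Data.Bool.Properties using (∧-zeroʳ)
open import Data.List using (List; []; _∷_; _++_; map; concatMap; applyUpTo)
open import Data.List.Properties using (map-∘)
open import Function using (id)
open import Relation.Nullary using (yes; no)
open import Relation.Nullary.Negation using (contradiction)
open import Relation.Binary.PropositionalEquality
  using (refl; sym; trans; cong; cong₂; module ≡-Reasoning)

open ≡-Reasoning

∑ : ℕ → (ℕ → ℤ) → ℤ
∑ zero    f = 0ℤ
∑ (suc L) f = f 0 + ∑ L (λ i → f (suc i))

∑-cong : ∀ L {f g : ℕ → ℤ} → (∀ i → f i ≡ g i) → ∑ L f ≡ ∑ L g
∑-cong zero    f≡g = refl
∑-cong (suc L) f≡g = cong₂ _+_ (f≡g 0) (∑-cong L (λ i → f≡g (suc i)))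

∑-+ : ∀ L (f g : ℕ → ℤ) → ∑ L (λ i → f i + g i) ≡ ∑ L f + ∑ L g
∑-+ zero    f g = refl
∑-+ (suc L) f g = trans (cong (_+_ (f 0 + g 0)) (∑-+ L _ _)) (interchange (f 0) (g 0) _ _)
  where
  interchange : ∀ a b c d → a + b + (c + d) ≡ a + c + (b + d)
  interchange = solve-∀

∑-*ˡ : ∀ L c (f : ℕ → ℤ) → ∑ L (λ i → c * f i) ≡ c * ∑ L f
∑-*ˡ zero    c f = sym (ℤP.*-zeroʳ c)
∑-*ˡ (suc L) c f = trans (cong (_+_ (c * f 0)) (∑-*ˡ L c _)) (sym (ℤP.*-distribˡ-+ c (f 0) _))

∑-+-* : ∀ L b (f g : ℕ → ℤ) → ∑ L (λ i → f i + b * g i) ≡ ∑ L f + b * ∑ L g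
∑-+-* L b f g = trans (∑-+ L f (λ i → b * g i)) (cong (_+_ (∑ L f)) (∑-*ˡ L b g))

∑-zero : ∀ L {f : ℕ → ℤ} → (∀ i → f i ≡ 0ℤ) → ∑ L f ≡ 0ℤ
∑-zero zero    f≡0 = refl
∑-zero (suc L) f≡0 = cong₂ _+_ (f≡0 0) (∑-zero L (λ i → f≡0 (suc i)))

∑-vanishing-tail : ∀ M L {f : ℕ → ℤ} → (∀ i → M ≤ i → f i ≡ 0ℤ) → M ≤ L → ∑ L f ≡ ∑ M f
∑-vanishing-tail zero    L           f≡0 _          = ∑-zero L (λ i → f≡0 i z≤n)
∑-vanishing-tail (suc M) (suc L) {f} f≡0 (s≤s M≤L) =
  cong (_+_ (f 0)) (∑-vanishing-tail M L (λ i M≤i → f≡0 (suc i) (s≤s M≤i)) M≤L)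

sumTo≡∑ : ∀ m f → sumTo m f ≡ ∑ (suc m) f
sumTo≡∑ m f = sum-applyUpTo id (suc m)
  where
  sum-applyUpTo : ∀ (g : ℕ → ℕ) L → sumℤ (map f (applyUpTo g L)) ≡ ∑ L (λ i → f (g i))
  sum-applyUpTo g zero    = refl
  sum-applyUpTo g (suc L) = cong (_+_ (f (g 0))) (sum-applyUpTo (λ i → g (suc i)) L)

atPred : ℕ → (ℕ → ℤ) → ℤ
atPred zero    f = 0ℤ
atPred (suc k) f = f k

atPred-cong : ∀ k {f g : ℕ → ℤ} → (∀ m → f m ≡ g m) → atPred k f ≡ atPred k g
atPred-cong zero    f≡g = refl
atPred-cong (suc k) f≡g = f≡g k

atPred-*ˡ : ∀ k c (f : ℕ → ℤ) → atPred k (λ m → c * f m) ≡ c * atPred k f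
atPred-*ˡ zero    c f = sym (ℤP.*-zeroʳ c)
atPred-*ˡ (suc k) c f = refl

atPred-*ʳ : ∀ k (f : ℕ → ℤ) c → atPred k f * c ≡ atPred k (λ m → f m * c)
atPred-*ʳ zero    f c = refl
atPred-*ʳ (suc k) f c = refl

∑-atPred : ∀ L k (g : ℕ → ℤ) (f : ℕ → ℕ → ℤ) →
           ∑ L (λ j → g j * atPred k (λ m → f m j)) ≡ atPred k (λ m → ∑ L (λ j → g j * f m j))
∑-atPred L zero    g f = ∑-zero L (λ j → ℤP.*-zeroʳ (g j))
∑-atPred L (suc k) g f = refl

m≤n+2*m : ∀ m n → m ≤ n ℕ.+ 2 ℕ.* m
m≤n+2*m m n = ℕP.≤-trans (ℕP.m≤m+n m (m ℕ.+ 0)) (ℕP.m≤n+m (2 ℕ.* m) n)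

n+2*[1+m]≡2+n+2*m : ∀ n m → n ℕ.+ 2 ℕ.* suc m ≡ suc (suc (n ℕ.+ 2 ℕ.* m))
n+2*[1+m]≡2+n+2*m n m =
  trans (ℕP.+-suc n _) (cong suc (trans (cong (n ℕ.+_) (ℕP.+-suc m (m ℕ.+ 0))) (ℕP.+-suc n _)))

m/2<n⇒m<2*n : ∀ {m n} → m / 2 < n → m < 2 ℕ.* n
m/2<n⇒m<2*n {m} {n} m/2<n with m <? 2 ℕ.* n
... | yes m<2n = m<2n
... | no  m≮2n = contradiction n≤m/2 (ℕP.<⇒≱ m/2<n)
  where
  n≤m/2 : n ≤ m / 2
  n≤m/2 = ℕP.≤-trans (ℕP.≤-reflexive (sym (m*n/n≡m n 2)))
                     (/-monoˡ-≤ 2 (ℕP.≤-trans (ℕP.≤-reflexive (ℕP.*-comm n 2)) (ℕP.≮⇒≥ m≮2n)))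

∑-peel₂ : ∀ L k (u f : ℕ → ℤ) →
  ∑ (suc L) (λ i → u i * f (k ℕ.+ 2 ℕ.* i))
  ≡ u 0 * f k + ∑ L (λ i → u (suc i) * f (suc (suc (k ℕ.+ 2 ℕ.* i))))
∑-peel₂ L k u f = cong₂ _+_ (cong (λ x → u 0 * f x) (ℕP.+-identityʳ k))
                            (∑-cong L (λ i → cong (λ x → u (suc i) * f x) (n+2*[1+m]≡2+n+2*m k i)))

atPred-∑-peel₂ : ∀ L k (κ : ℕ → ℕ) → (∀ m → κ (suc m) ≡ suc (κ m)) →
  ∀ (u : ℕ → ℕ → ℤ) (f : ℕ → ℤ) →
  atPred k (λ m → ∑ (suc L) (λ i → u m i * f (κ m ℕ.+ 2 ℕ.* i)))
  ≡ atPred k (λ m → u m 0) * atPred (κ k) f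
    + ∑ L (λ i → atPred k (λ m → u m (suc i)) * f (suc (κ k ℕ.+ 2 ℕ.* i)))
atPred-∑-peel₂ L zero    κ κ-suc u f = sym (trans (ℤP.+-identityˡ _) (∑-zero L (λ _ → refl)))
atPred-∑-peel₂ L (suc m) κ κ-suc u f = trans (∑-peel₂ L (κ m) (u m) f)
  (cong₂ _+_ (cong (λ x → u m 0 * atPred x f) (sym (κ-suc m)))
             (∑-cong L (λ i → cong (λ x → u m (suc i) * f (suc (x ℕ.+ 2 ℕ.* i))) (sym (κ-suc m)))))

module _ {A : Set} where

  sum-map-cong : ∀ {f g : A → ℤ} → (∀ x → f x ≡ g x) → ∀ xs → sumℤ (map f xs) ≡ sumℤ (map g xs)
  sum-map-cong f≡g []       = refl
  sum-map-cong f≡g (x ∷ xs) = cong₂ _+_ (f≡g x) (sum-map-cong f≡g xs)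

  sum-map-++ : ∀ (f : A → ℤ) xs ys → sumℤ (map f (xs ++ ys)) ≡ sumℤ (map f xs) + sumℤ (map f ys)
  sum-map-++ f []       ys = sym (ℤP.+-identityˡ _)
  sum-map-++ f (x ∷ xs) ys = trans (cong (_+_ (f x)) (sum-map-++ f xs ys)) (sym (ℤP.+-assoc (f x) _ _))

  sum-map-factor : ∀ {f g : A → ℤ} c → (∀ x → f x ≡ c * g x) → ∀ xs →
                   sumℤ (map f xs) ≡ c * sumℤ (map g xs)
  sum-map-factor c f≡cg []       = sym (ℤP.*-zeroʳ c)
  sum-map-factor c f≡cg (x ∷ xs) =
    trans (cong₂ _+_ (f≡cg x) (sum-map-factor c f≡cg xs)) (sym (ℤP.*-distribˡ-+ c _ _))

  sum-map-atPred : ∀ k (f : ℕ → A → ℤ) xs →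
                   sumℤ (map (λ x → atPred k (λ m → f m x)) xs) ≡ atPred k (λ m → sumℤ (map (f m) xs))
  sum-map-atPred zero    f []       = refl
  sum-map-atPred zero    f (x ∷ xs) = trans (ℤP.+-identityˡ _) (sum-map-atPred zero f xs)
  sum-map-atPred (suc k) f xs       = refl

sum-map-concatMap-∷ : ∀ {A : Set} (f : List A → ℤ) ws ss →
  sumℤ (map f (concatMap (λ s → map (s ∷_) ws) ss))
  ≡ sumℤ (map (λ s → sumℤ (map (λ w → f (s ∷ w)) ws)) ss)
sum-map-concatMap-∷ f ws []       = refl
sum-map-concatMap-∷ f ws (s ∷ ss) = trans (sum-map-++ f (map (s ∷_) ws) _)
  (cong₂ _+_ (cong sumℤ (sym (map-∘ ws))) (sum-map-concatMap-∷ f ws ss))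

if-* : ∀ b c x → (if b then c * x else 0ℤ) ≡ c * (if b then x else 0ℤ)
if-* true  c x = refl
if-* false c x = sym (ℤP.*-zeroʳ c)

module _ (q : ℤ) where

  gauss-vanish : ∀ {n k} → n < k → gauss q n k ≡ 0ℤ
  gauss-vanish {zero}  {suc k} _         = refl
  gauss-vanish {suc n} {suc k} (s≤s n<k) = begin
    gauss q n k + q ^ suc k * gauss q n (suc k)
      ≡⟨ cong₂ (λ a b → a + q ^ suc k * b) (gauss-vanish n<k) (gauss-vanish (ℕP.m<n⇒m<1+n n<k)) ⟩
    0ℤ + q ^ suc k * 0ℤ
      ≡⟨ trans (ℤP.+-identityˡ _) (ℤP.*-zeroʳ (q ^ suc k)) ⟩
    0ℤ ∎

  gauss-diag : ∀ k → gauss q k k ≡ 1ℤ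
  gauss-diag zero    = refl
  gauss-diag (suc k) = trans (cong₂ (λ a b → a + q ^ suc k * b) (gauss-diag k) (gauss-vanish (ℕP.n<1+n k)))
                             (cong (_+_ 1ℤ) (ℤP.*-zeroʳ (q ^ suc k)))

  qbin : ℕ → ℕ → ℤ
  qbin a b = gauss q (a ℕ.+ b) a

  qbin-zeroʳ : ∀ a → qbin a 0 ≡ 1ℤ
  qbin-zeroʳ a = trans (cong (λ x → gauss q x a) (ℕP.+-identityʳ a)) (gauss-diag a)

  qbin-sucˡ : ∀ a b → qbin (suc a) b ≡ qbin a b + q ^ suc a * atPred b (qbin (suc a))
  qbin-sucˡ a b = cong (λ x → qbin a b + q ^ suc a * x) (gauss-below b)
    where
    gauss-below : ∀ b → gauss q (a ℕ.+ b) (suc a) ≡ atPred b (qbin (suc a))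
    gauss-below zero    = gauss-vanish (s≤s (ℕP.≤-reflexive (ℕP.+-identityʳ a)))
    gauss-below (suc b) = cong (λ x → gauss q x (suc a)) (ℕP.+-suc a b)

  qbin-sucʳ : ∀ a b → qbin a (suc b) ≡ atPred a (λ a′ → qbin a′ (suc b)) + q ^ a * qbin a b
  qbin-sucʳ zero    b = refl
  qbin-sucʳ (suc a) b = qbin-sucˡ a (suc b)

  qbin-sucˡ′ : ∀ a b → qbin (suc a) b ≡ q ^ b * qbin a b + atPred b (qbin (suc a))
  qbin-sucˡ′ a       zero    = trans (qbin-zeroʳ (suc a)) (cong (λ x → 1ℤ * x + 0ℤ) (sym (qbin-zeroʳ a)))
  qbin-sucˡ′ zero    (suc b) = begin
    qbin 1 (suc b)                          ≡⟨ qbin-sucˡ 0 (suc b) ⟩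
    1ℤ + q ^ 1 * qbin 1 b                   ≡⟨ cong (λ x → 1ℤ + q ^ 1 * x) (qbin-sucˡ′ 0 b) ⟩
    1ℤ + q ^ 1 * (q ^ b * 1ℤ + P)           ≡⟨ regroup q (q ^ b) P ⟩
    q ^ suc b * 1ℤ + (1ℤ + q ^ 1 * P)       ≡⟨ cong (_+_ (q ^ suc b * 1ℤ)) (sym (qbin-sucˡ 0 b)) ⟩
    q ^ suc b * qbin 0 (suc b) + qbin 1 b   ∎
    where
    P = atPred b (qbin 1)
    regroup : ∀ q Q P → 1ℤ + q * 1ℤ * (Q * 1ℤ + P) ≡ q * Q * 1ℤ + (1ℤ + q * 1ℤ * P)
    regroup = solve-∀
  qbin-sucˡ′ (suc a) (suc b) = begin
    qbin (suc (suc a)) (suc b)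
      ≡⟨ qbin-sucˡ (suc a) (suc b) ⟩
    qbin (suc a) (suc b) + q ^ suc (suc a) * Z
      ≡⟨ cong₂ (λ u v → u + q ^ suc (suc a) * v) (qbin-sucˡ′ a (suc b)) (qbin-sucˡ′ (suc a) b) ⟩
    (q ^ suc b * X + Y) + q ^ suc (suc a) * (q ^ b * Y + P)
      ≡⟨ regroup q (q ^ a) (q ^ b) X Y P ⟩
    q ^ suc b * (X + q ^ suc a * Y) + (Y + q ^ suc (suc a) * P)
      ≡⟨ cong₂ (λ u v → q ^ suc b * u + v) (sym (qbin-sucˡ a (suc b))) (sym (qbin-sucˡ (suc a) b)) ⟩
    q ^ suc b * qbin (suc a) (suc b) + Z ∎
    where
    X = qbin a (suc b)
    Y = qbin (suc a) b
    Z = qbin (suc (suc a)) b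
    P = atPred b (qbin (suc (suc a)))
    regroup : ∀ q Qa Qb X Y P → (q * Qb * X + Y) + q * (q * Qa) * (Qb * Y + P)
                                ≡ q * Qb * (X + q * Qa * Y) + (Y + q * (q * Qa) * P)
    regroup = solve-∀

  qbin-absorb : ∀ a b → (1ℤ - q ^ suc a) * qbin (suc a) b ≡ (1ℤ - q ^ suc (a ℕ.+ b)) * qbin a b
  qbin-absorb a b = begin
    (1ℤ - q ^ suc a) * X
      ≡⟨ split (q ^ suc a) X ⟩
    X - q ^ suc a * X
      ≡⟨ cong₂ (λ u v → u - q ^ suc a * v) (qbin-sucˡ a b) (qbin-sucˡ′ a b) ⟩
    (A + q ^ suc a * P) - q ^ suc a * (q ^ b * A + P)
      ≡⟨ cancel (q ^ suc a) (q ^ b) A P ⟩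
    (1ℤ - q ^ suc a * q ^ b) * A
      ≡⟨ cong (λ x → (1ℤ - x) * A) (sym (ℤP.^-distribˡ-+-* q (suc a) b)) ⟩
    (1ℤ - q ^ suc (a ℕ.+ b)) * A ∎
    where
    X = qbin (suc a) b
    A = qbin a b
    P = atPred b (qbin (suc a))
    split : ∀ Q X → (1ℤ - Q) * X ≡ X - Q * X
    split = solve-∀
    cancel : ∀ Qa Qb A P → (A + Qa * P) - Qa * (Qb * A + P) ≡ (1ℤ - Qa * Qb) * A
    cancel = solve-∀

  qMultinomial : ℕ → ℕ → ℕ → ℤ
  qMultinomial h n i = qbin h (i ℕ.+ n) * qbin i n

  qMultinomial-suc : ∀ h n i →
    qMultinomial h n (suc i) ≡ q ^ h * atPred n (λ m → qMultinomial h m (suc i))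
                               + atPred h (λ h′ → qMultinomial h′ n (suc i))
                               + q ^ (h ℕ.+ n) * qMultinomial h n i
  qMultinomial-suc h n i = begin
    qbin h (suc (i ℕ.+ n)) * Z
      ≡⟨ cong (_* Z) (qbin-sucʳ h (i ℕ.+ n)) ⟩
    (Xh + q ^ h * X) * Z
      ≡⟨ ℤP.*-distribʳ-+ Z Xh (q ^ h * X) ⟩
    Xh * Z + q ^ h * X * Z
      ≡⟨ cong₂ _+_ (atPred-*ʳ h _ Z) (cong (q ^ h * X *_) (qbin-sucˡ′ i n)) ⟩
    Gh + q ^ h * X * (q ^ n * Y + Zn)
      ≡⟨ regroup (q ^ h) (q ^ n) X Y Zn Gh ⟩
    q ^ h * (X * Zn) + Gh + q ^ h * q ^ n * (X * Y)
      ≡⟨ cong₂ (λ u v → q ^ h * u + Gh + v * (X * Y)) (right-factor n) (sym (ℤP.^-distribˡ-+-* q h n)) ⟩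
    q ^ h * atPred n (λ m → qMultinomial h m (suc i)) + Gh + q ^ (h ℕ.+ n) * qMultinomial h n i ∎
    where
    X = qbin h (i ℕ.+ n)
    Y = qbin i n
    Z = qbin (suc i) n
    Zn = atPred n (qbin (suc i))
    Xh = atPred h (λ h′ → qbin h′ (suc (i ℕ.+ n)))
    Gh = atPred h (λ h′ → qMultinomial h′ n (suc i))
    regroup : ∀ Qh Qn X Y P G → G + Qh * X * (Qn * Y + P) ≡ Qh * (X * P) + G + Qh * Qn * (X * Y)
    regroup = solve-∀
    right-factor : ∀ n → qbin h (i ℕ.+ n) * atPred n (qbin (suc i)) ≡ atPred n (λ m → qMultinomial h m (suc i))
    right-factor zero    = ℤP.*-zeroʳ (qbin h (i ℕ.+ 0))
    right-factor (suc m) = cong (λ x → qbin h x * qbin (suc i) m) (ℕP.+-suc i m)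

  qMultinomial-absorb : ∀ h n i →
    (1ℤ - q ^ suc h) * qMultinomial (suc h) n i ≡ (1ℤ - q ^ suc i * q ^ (h ℕ.+ n)) * qMultinomial h n i
  qMultinomial-absorb h n i = begin
    (1ℤ - q ^ suc h) * (qbin (suc h) (i ℕ.+ n) * Y)
      ≡⟨ sym (ℤP.*-assoc (1ℤ - q ^ suc h) (qbin (suc h) (i ℕ.+ n)) Y) ⟩
    (1ℤ - q ^ suc h) * qbin (suc h) (i ℕ.+ n) * Y
      ≡⟨ cong (_* Y) (qbin-absorb h (i ℕ.+ n)) ⟩
    (1ℤ - q ^ suc (h ℕ.+ (i ℕ.+ n))) * X * Y
      ≡⟨ cong (λ e → (1ℤ - e) * X * Y) (trans (cong (q ^_) exponent) (ℤP.^-distribˡ-+-* q (suc i) (h ℕ.+ n))) ⟩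
    (1ℤ - q ^ suc i * q ^ (h ℕ.+ n)) * X * Y
      ≡⟨ ℤP.*-assoc (1ℤ - q ^ suc i * q ^ (h ℕ.+ n)) X Y ⟩
    (1ℤ - q ^ suc i * q ^ (h ℕ.+ n)) * qMultinomial h n i ∎
    where
    X = qbin h (i ℕ.+ n)
    Y = qbin i n
    exponent : suc (h ℕ.+ (i ℕ.+ n)) ≡ suc i ℕ.+ (h ℕ.+ n)
    exponent = cong suc (trans (sym (ℕP.+-assoc h i n))
                               (trans (cong (ℕ._+ n) (ℕP.+-comm h i)) (ℕP.+-assoc i h n)))

  -- qMultinomial-suc at i = −1. It fails for h = n = 0, which the factor atPred (h + n) t kills.
  qMultinomial-suc₀ : ∀ h n (t : ℕ → ℤ) →
    (q ^ h * atPred n (λ m → qMultinomial h m 0) + atPred h (λ h′ → qMultinomial h′ n 0)) * atPred (h ℕ.+ n) t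
    ≡ qMultinomial h n 0 * atPred (h ℕ.+ n) t
  qMultinomial-suc₀ zero    zero    t = refl
  qMultinomial-suc₀ zero    (suc n) t = refl
  qMultinomial-suc₀ (suc h) zero    t = cong (_* atPred (suc h ℕ.+ 0) t) boundary
    where
    boundary : q ^ suc h * 0ℤ + qbin h 0 * 1ℤ ≡ qbin (suc h) 0 * 1ℤ
    boundary = trans (cong₂ (λ a b → a + b * 1ℤ) (ℤP.*-zeroʳ (q ^ suc h)) (qbin-zeroʳ h))
                     (cong (_* 1ℤ) (sym (qbin-zeroʳ (suc h))))
  qMultinomial-suc₀ (suc h) (suc n) t = cong (_* atPred (suc h ℕ.+ suc n) t) (begin
    q ^ suc h * (B * 1ℤ) + A * 1ℤ   ≡⟨ regroup (q ^ suc h) A B ⟩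
    (A + q ^ suc h * B) * 1ℤ       ≡⟨ cong (_* 1ℤ) (sym (qbin-sucˡ h (suc n))) ⟩
    qbin (suc h) (suc n) * 1ℤ      ∎)
    where
    A = qbin h (suc n)
    B = qbin (suc h) n
    regroup : ∀ Q A B → Q * (B * 1ℤ) + A * 1ℤ ≡ (A + Q * B) * 1ℤ
    regroup = solve-∀

-- The summand of the inner sum of RNn, for m = n + 2i.
binomialMinor : ℕ → ℕ → ℕ → ℤ
binomialMinor N m j = binZ N j * binZ N (m ℕ.+ j) - binZpred N j * binZ N (m ℕ.+ j ℕ.+ 1)

+1≡suc : ∀ x → x ℕ.+ 1 ≡ suc x
+1≡suc x = ℕP.+-comm x 1

binZ-suc : ∀ N x → binZ (suc N) x ≡ binZ N x + binZpred N x
binZ-suc N zero    = refl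
binZ-suc N (suc x) = trans (cong +_ (sym (nCk+nC[k+1]≡[n+1]C[k+1] N x)))
                           (trans (ℤP.pos-+ (N C x) (N C suc x)) (ℤP.+-comm (binZ N x) (binZ N (suc x))))

binZpred-suc : ∀ N x → binZpred (suc N) x ≡ binZpred N x + atPred x (binZpred N)
binZpred-suc N zero    = refl
binZpred-suc N (suc x) = binZ-suc N x

binomialMinor-vanish : ∀ {N} m j → N < m ℕ.+ j → binomialMinor N m j ≡ 0ℤ
binomialMinor-vanish {N} m j N<m+j = begin
  binZ N j * binZ N (m ℕ.+ j) - binZpred N j * binZ N (m ℕ.+ j ℕ.+ 1)
    ≡⟨ cong₂ (λ u v → binZ N j * u - binZpred N j * v)
             (vanish N<m+j) (vanish (ℕP.<-≤-trans N<m+j (ℕP.m≤m+n _ 1))) ⟩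
  binZ N j * 0ℤ - binZpred N j * 0ℤ
    ≡⟨ zeros (binZ N j) (binZpred N j) ⟩
  0ℤ ∎
  where
  vanish : ∀ {x} → N < x → binZ N x ≡ 0ℤ
  vanish N<x = cong +_ (k>n⇒nCk≡0 N<x)
  zeros : ∀ a b → a * 0ℤ - b * 0ℤ ≡ 0ℤ
  zeros = solve-∀

binomialMinor-suc : ∀ N k j →
  binomialMinor (suc N) k j ≡ atPred k (λ k′ → binomialMinor N k′ j) + binomialMinor N k j
                              + atPred j (binomialMinor N k) + atPred j (binomialMinor N (suc k))
binomialMinor-suc N k j = begin
  binZ (suc N) j * binZ (suc N) (k ℕ.+ j) - binZpred (suc N) j * binZ (suc N) (k ℕ.+ j ℕ.+ 1)
    ≡⟨ cong₂ (λ u v → u * binZ (suc N) (k ℕ.+ j) - v * binZ (suc N) (k ℕ.+ j ℕ.+ 1))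
             (binZ-suc N j) (binZpred-suc N j) ⟩
  (a₀ + a₁) * binZ (suc N) (k ℕ.+ j) - (a₁ + a₂) * binZ (suc N) (k ℕ.+ j ℕ.+ 1)
    ≡⟨ cong₂ (λ u v → (a₀ + a₁) * u - (a₁ + a₂) * v) (binZ-suc N (k ℕ.+ j))
             (trans (binZ-suc N (k ℕ.+ j ℕ.+ 1)) (cong (λ x → b₁ + binZpred N x) (+1≡suc (k ℕ.+ j)))) ⟩
  (a₀ + a₁) * (b₀ + b₋) - (a₁ + a₂) * (b₁ + b₀)
    ≡⟨ expand a₀ a₁ a₂ b₋ b₀ b₁ ⟩
  (a₀ * b₋ - a₁ * b₀) + (a₀ * b₀ - a₁ * b₁) + (a₁ * b₋ - a₂ * b₀) + (a₁ * b₀ - a₂ * b₁)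
    ≡⟨ sym (cong₂ _+_ (cong₂ _+_ (cong (_+ binomialMinor N k j) (shift-k k)) (shift-j j)) (shift-j-suc j)) ⟩
  atPred k (λ k′ → binomialMinor N k′ j) + binomialMinor N k j
  + atPred j (binomialMinor N k) + atPred j (binomialMinor N (suc k)) ∎
  where
  a₀ = binZ N j
  a₁ = binZpred N j
  a₂ = atPred j (binZpred N)
  b₋ = binZpred N (k ℕ.+ j)
  b₀ = binZ N (k ℕ.+ j)
  b₁ = binZ N (k ℕ.+ j ℕ.+ 1)
  expand : ∀ a₀ a₁ a₂ b₋ b₀ b₁ →
    (a₀ + a₁) * (b₀ + b₋) - (a₁ + a₂) * (b₁ + b₀)
    ≡ (a₀ * b₋ - a₁ * b₀) + (a₀ * b₀ - a₁ * b₁) + (a₁ * b₋ - a₂ * b₀) + (a₁ * b₀ - a₂ * b₁)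
  expand = solve-∀
  shift-k : ∀ k → atPred k (λ k′ → binomialMinor N k′ j)
                  ≡ a₀ * binZpred N (k ℕ.+ j) - a₁ * binZ N (k ℕ.+ j)
  shift-k zero     = sym (antisym a₀ a₁)
    where
    antisym : ∀ a b → a * b - b * a ≡ 0ℤ
    antisym = solve-∀
  shift-k (suc k′) = cong (λ x → a₀ * binZ N (k′ ℕ.+ j) - a₁ * binZ N x) (+1≡suc (k′ ℕ.+ j))
  shift-j : ∀ j → atPred j (binomialMinor N k)
                  ≡ binZpred N j * binZpred N (k ℕ.+ j) - atPred j (binZpred N) * binZ N (k ℕ.+ j)
  shift-j zero     = refl
  shift-j (suc j′) = cong₂ (λ u v → binZ N j′ * u - binZpred N j′ * binZ N v)
    (cong (binZpred N) (sym (ℕP.+-suc k j′))) (trans (+1≡suc (k ℕ.+ j′)) (sym (ℕP.+-suc k j′)))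
  shift-j-suc : ∀ j → atPred j (binomialMinor N (suc k))
                      ≡ binZpred N j * binZ N (k ℕ.+ j) - atPred j (binZpred N) * binZ N (k ℕ.+ j ℕ.+ 1)
  shift-j-suc zero     = refl
  shift-j-suc (suc j′) =
    cong (λ x → binZ N j′ * binZ N x - binZpred N j′ * binZ N (x ℕ.+ 1)) (sym (ℕP.+-suc k j′))

module _ (y : ℤ) where

  minorSum : ℕ → ℕ → ℤ
  minorSum N m = ∑ (suc N) (λ j → y ^ j * binomialMinor N m j)

  minorTerm-vanish : ∀ {N} m j → N < m ℕ.+ j → y ^ j * binomialMinor N m j ≡ 0ℤ
  minorTerm-vanish m j N<m+j = trans (cong (y ^ j *_) (binomialMinor-vanish m j N<m+j)) (ℤP.*-zeroʳ (y ^ j))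

  minorSum-length : ∀ {L} N m → N < L → ∑ L (λ j → y ^ j * binomialMinor N m j) ≡ minorSum N m
  minorSum-length N m N<L =
    ∑-vanishing-tail (suc N) _ (λ j N<j → minorTerm-vanish m j (ℕP.<-≤-trans N<j (ℕP.m≤n+m j m))) N<L

  minorSum-vanish : ∀ {N m} → N < m → minorSum N m ≡ 0ℤ
  minorSum-vanish {N} {m} N<m =
    ∑-zero (suc N) (λ j → minorTerm-vanish m j (ℕP.<-≤-trans N<m (ℕP.m≤m+n m j)))

  minorSum-vanish-at : ∀ N k i → N < i → minorSum N (k ℕ.+ 2 ℕ.* i) ≡ 0ℤ
  minorSum-vanish-at N k i N<i = minorSum-vanish (ℕP.<-≤-trans N<i (m≤n+2*m i k))

  minorSum-sumTo : ∀ N m → sumTo (N ∸ m) (λ j → y ^ j * binomialMinor N m j) ≡ minorSum N m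
  minorSum-sumTo N m = trans (sumTo≡∑ (N ∸ m) (λ j → y ^ j * binomialMinor N m j))
    (sym (∑-vanishing-tail (suc (N ∸ m)) (suc N)
      (λ j N∸m<j → minorTerm-vanish m j (ℕP.≤-<-trans (ℕP.m≤n+m∸n N m) (ℕP.+-monoʳ-< m N∸m<j)))
      (s≤s (ℕP.m∸n≤m N m))))

  ∑-pow-atPred : ∀ L (f : ℕ → ℤ) → ∑ (suc L) (λ j → y ^ j * atPred j f) ≡ y * ∑ L (λ j → y ^ j * f j)
  ∑-pow-atPred L f = trans (ℤP.+-identityˡ _)
    (trans (∑-cong L (λ j → ℤP.*-assoc y (y ^ j) (f j))) (∑-*ˡ L y (λ j → y ^ j * f j)))

  minorSum-suc : ∀ N k →
    minorSum (suc N) k ≡ atPred k (minorSum N) + (1ℤ + y) * minorSum N k + y * minorSum N (suc k)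
  minorSum-suc N k = begin
    ∑ L (λ j → y ^ j * binomialMinor (suc N) k j)
      ≡⟨ ∑-cong L pointwise ⟩
    ∑ L (λ j → f₁ j + f₂ j + f₃ j + f₄ j)
      ≡⟨ trans (∑-+ L (λ j → f₁ j + f₂ j + f₃ j) f₄) (cong (_+ ∑ L f₄)
           (trans (∑-+ L (λ j → f₁ j + f₂ j) f₃) (cong (_+ ∑ L f₃) (∑-+ L f₁ f₂)))) ⟩
    ∑ L f₁ + ∑ L f₂ + ∑ L f₃ + ∑ L f₄
      ≡⟨ cong₂ _+_ (cong₂ _+_ (cong₂ _+_ first (minorSum-length N k N<L))
                              (∑-pow-atPred (suc N) (binomialMinor N k)))
                   (∑-pow-atPred (suc N) (binomialMinor N (suc k))) ⟩
    atPred k (minorSum N) + minorSum N k + y * minorSum N k + y * minorSum N (suc k)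
      ≡⟨ collect (atPred k (minorSum N)) (minorSum N k) (minorSum N (suc k)) y ⟩
    atPred k (minorSum N) + (1ℤ + y) * minorSum N k + y * minorSum N (suc k) ∎
    where
    L = suc (suc N)
    N<L : N < L
    N<L = ℕP.m<n⇒m<1+n (ℕP.n<1+n N)
    f₁ f₂ f₃ f₄ : ℕ → ℤ
    f₁ j = y ^ j * atPred k (λ k′ → binomialMinor N k′ j)
    f₂ j = y ^ j * binomialMinor N k j
    f₃ j = y ^ j * atPred j (binomialMinor N k)
    f₄ j = y ^ j * atPred j (binomialMinor N (suc k))
    distrib : ∀ w a b c d → w * (a + b + c + d) ≡ w * a + w * b + w * c + w * d
    distrib = solve-∀
    pointwise : ∀ j → y ^ j * binomialMinor (suc N) k j ≡ f₁ j + f₂ j + f₃ j + f₄ j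
    pointwise j = trans (cong (y ^ j *_) (binomialMinor-suc N k j))
      (distrib (y ^ j) (atPred k (λ k′ → binomialMinor N k′ j)) (binomialMinor N k j)
                       (atPred j (binomialMinor N k)) (atPred j (binomialMinor N (suc k))))
    collect : ∀ a b c y → a + b + y * b + y * c ≡ a + (1ℤ + y) * b + y * c
    collect = solve-∀
    first : ∑ L f₁ ≡ atPred k (minorSum N)
    first = trans (∑-atPred L k (y ^_) (binomialMinor N)) (atPred-cong k (λ k′ → minorSum-length N k′ N<L))

module _ (y q : ℤ) where

  neighbours : (ℕ → ℕ → ℤ) → ℕ → ℕ → ℤ
  neighbours s h n = q ^ h * atPred n (s h) + y * atPred h (λ h′ → s h′ n)

  -- If s h n sums over paths of length N from height h, extend s h n sums over those of length
  -- N + 1: a first step ↗ has weight 1 or −q^(h+1), → has weight 1 + y or q^h, and ↘ has weight y.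
  extend : (ℕ → ℕ → ℤ) → ℕ → ℕ → ℤ
  extend s h n = (1ℤ - q ^ suc h) * s (suc h) n + (1ℤ + y) * s h n + neighbours s h n

  extend-cong : ∀ {s t : ℕ → ℕ → ℤ} → (∀ h n → s h n ≡ t h n) → ∀ h n → extend s h n ≡ extend t h n
  extend-cong s≡t h n =
    cong₂ _+_ (cong₂ _+_ (cong ((1ℤ - q ^ suc h) *_) (s≡t (suc h) n)) (cong ((1ℤ + y) *_) (s≡t h n)))
              (cong₂ _+_ (cong (q ^ h *_) (atPred-cong n (s≡t h)))
                         (cong (y *_) (atPred-cong h (λ h′ → s≡t h′ n))))

  contribution : ℕ → ℕ → List Step → ℤ
  contribution h n p = if isMotzkinFrom h p ∧ (countFlatQ p ≡ᵇ n) then weightFrom y q h p else 0ℤ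

  pathSum : ℕ → ℕ → ℕ → ℤ
  pathSum N h n = sumℤ (map (contribution h n) (words N))

  contribution-scaled : ∀ h n c p →
    (if isMotzkinFrom h p ∧ (countFlatQ p ≡ᵇ n) then c * weightFrom y q h p else 0ℤ)
    ≡ c * contribution h n p
  contribution-scaled h n c p = if-* (isMotzkinFrom h p ∧ (countFlatQ p ≡ᵇ n)) c (weightFrom y q h p)

  -- The splits on h only let isMotzkinFrom, which matches on the height first, compute.
  contribution-upOne : ∀ h n p → contribution h n (upOne ∷ p) ≡ contribution (suc h) n p
  contribution-upOne zero    n p = refl
  contribution-upOne (suc h) n p = refl

  contribution-upQ : ∀ h n p → contribution h n (upQ ∷ p) ≡ (- (q ^ suc h)) * contribution (suc h) n p
  contribution-upQ zero    n p = contribution-scaled 1 n (- (q ^ 1)) p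
  contribution-upQ (suc h) n p = contribution-scaled (suc (suc h)) n (- (q ^ suc (suc h))) p

  contribution-flatOneY : ∀ h n p → contribution h n (flatOneY ∷ p) ≡ (1ℤ + y) * contribution h n p
  contribution-flatOneY zero    n p = contribution-scaled 0 n (1ℤ + y) p
  contribution-flatOneY (suc h) n p = contribution-scaled (suc h) n (1ℤ + y) p

  contribution-flatQ : ∀ h n p → contribution h n (flatQ ∷ p) ≡ q ^ h * atPred n (λ m → contribution h m p)
  contribution-flatQ zero    zero    p rewrite ∧-zeroʳ (isMotzkinFrom 0 p)       = refl
  contribution-flatQ (suc h) zero    p rewrite ∧-zeroʳ (isMotzkinFrom (suc h) p) =
    sym (ℤP.*-zeroʳ (q ^ suc h))
  contribution-flatQ zero    (suc m) p = contribution-scaled 0 m (q ^ 0) p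
  contribution-flatQ (suc h) (suc m) p = contribution-scaled (suc h) m (q ^ suc h) p

  contribution-down : ∀ h n p → contribution h n (down ∷ p) ≡ y * atPred h (λ h′ → contribution h′ n p)
  contribution-down zero    n p = sym (ℤP.*-zeroʳ y)
  contribution-down (suc h) n p = contribution-scaled h n y p

  pathSum-suc : ∀ N h n → pathSum (suc N) h n ≡ extend (pathSum N) h n
  pathSum-suc N h n = begin
    pathSum (suc N) h n
      ≡⟨ sum-map-concatMap-∷ (contribution h n) W allSteps ⟩
    σ upOne + (σ upQ + (σ flatOneY + (σ flatQ + (σ down + 0ℤ))))
      ≡⟨ cong₂ _+_ (sum-map-cong (contribution-upOne h n) W)
        (cong₂ _+_ (sum-map-factor (- (q ^ suc h)) (contribution-upQ h n) W)
        (cong₂ _+_ (sum-map-factor (1ℤ + y) (contribution-flatOneY h n) W)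
        (cong₂ _+_ (trans (sum-map-factor (q ^ h) (contribution-flatQ h n) W)
                          (cong (q ^ h *_) (sum-map-atPred n (contribution h) W)))
        (cong (_+ 0ℤ) (trans (sum-map-factor y (contribution-down h n) W)
                             (cong (y *_) (sum-map-atPred h (λ h′ → contribution h′ n) W))))))) ⟩
    P (suc h) n + ((- (q ^ suc h)) * P (suc h) n + ((1ℤ + y) * P h n
      + (q ^ h * atPred n (P h) + (y * atPred h (λ h′ → P h′ n) + 0ℤ))))
      ≡⟨ regroup (P (suc h) n) (q ^ suc h) (P h n) y (q ^ h * atPred n (P h)) (y * atPred h (λ h′ → P h′ n)) ⟩
    extend (pathSum N) h n ∎
    where
    W = words N
    P = pathSum N
    σ : Step → ℤ
    σ s = sumℤ (map (λ p → contribution h n (s ∷ p)) W)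
    regroup : ∀ a Q b y c d → a + ((- Q) * a + ((1ℤ + y) * b + (c + (d + 0ℤ))))
                              ≡ (1ℤ - Q) * a + (1ℤ + y) * b + (c + d)
    regroup = solve-∀

  signedWeight : ℕ → ℤ
  signedWeight i = (- y) ^ i * q ^ (suc i C 2)

  signedWeight-suc : ∀ i → signedWeight (suc i) ≡ (- y) * q ^ suc i * signedWeight i
  signedWeight-suc i = begin
    (- y) ^ suc i * q ^ (suc (suc i) C 2)
      ≡⟨ cong (λ e → (- y) ^ suc i * q ^ e) triangular ⟩
    (- y) * (- y) ^ i * q ^ (suc i ℕ.+ suc i C 2)
      ≡⟨ cong ((- y) * (- y) ^ i *_) (ℤP.^-distribˡ-+-* q (suc i) (suc i C 2)) ⟩
    (- y) * (- y) ^ i * (q ^ suc i * q ^ (suc i C 2))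
      ≡⟨ regroup (- y) ((- y) ^ i) (q ^ suc i) (q ^ (suc i C 2)) ⟩
    (- y) * q ^ suc i * signedWeight i ∎
    where
    triangular : suc (suc i) C 2 ≡ suc i ℕ.+ suc i C 2
    triangular = trans (sym (nCk+nC[k+1]≡[n+1]C[k+1] (suc i) 1)) (cong (ℕ._+ (suc i C 2)) (nC1≡n (suc i)))
    regroup : ∀ a A Q B → a * A * (Q * B) ≡ a * Q * (A * B)
    regroup = solve-∀

  coefficient : ℕ → ℕ → ℕ → ℤ
  coefficient h n i = y ^ h * signedWeight i * qMultinomial q h n i

  neighbours-coefficient : ∀ h n j →
    neighbours (λ h′ n′ → coefficient h′ n′ j) h n
    ≡ y ^ h * signedWeight j
      * (q ^ h * atPred n (λ m → qMultinomial q h m j) + atPred h (λ h′ → qMultinomial q h′ n j))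
  neighbours-coefficient h n j = begin
    q ^ h * atPred n (λ m → c * G h m) + y * atPred h (λ h′ → coefficient h′ n j)
      ≡⟨ cong₂ (λ u v → q ^ h * u + v) (atPred-*ˡ n c (G h)) (down-neighbour h) ⟩
    q ^ h * (c * atPred n (G h)) + c * atPred h (λ h′ → G h′ n)
      ≡⟨ regroup (q ^ h) c (atPred n (G h)) (atPred h (λ h′ → G h′ n)) ⟩
    c * (q ^ h * atPred n (G h) + atPred h (λ h′ → G h′ n)) ∎
    where
    c = y ^ h * signedWeight j
    G : ℕ → ℕ → ℤ
    G h′ n′ = qMultinomial q h′ n′ j
    regroup : ∀ Q c a b → Q * (c * a) + c * b ≡ c * (Q * a + b)
    regroup = solve-∀
    down-neighbour : ∀ h → y * atPred h (λ h′ → coefficient h′ n j)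
                           ≡ y ^ h * signedWeight j * atPred h (λ h′ → G h′ n)
    down-neighbour zero     = trans (ℤP.*-zeroʳ y) (sym (ℤP.*-zeroʳ (1ℤ * signedWeight j)))
    down-neighbour (suc h′) = assoc y (y ^ h′) (signedWeight j) (G h′ n)
      where
      assoc : ∀ y Y w g → y * (Y * w * g) ≡ y * Y * w * g
      assoc = solve-∀

  coefficient-suc : ∀ h n i →
    (1ℤ - q ^ suc h) * coefficient (suc h) n i + neighbours (λ h′ n′ → coefficient h′ n′ (suc i)) h n
    ≡ coefficient h n (suc i) + y * coefficient h n i
  coefficient-suc h n i = begin
    (1ℤ - q ^ suc h) * (y * Y * W * G′) + neighbours (λ h′ n′ → coefficient h′ n′ (suc i)) h n
      ≡⟨ cong₂ _+_ (regroup₁ (1ℤ - q ^ suc h) y Y W G′) (neighbours-coefficient h n (suc i)) ⟩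
    y * Y * W * ((1ℤ - q ^ suc h) * G′) + Y * signedWeight (suc i) * Nb
      ≡⟨ cong₂ (λ u v → y * Y * W * u + Y * v * Nb) (qMultinomial-absorb q h n i) (signedWeight-suc i) ⟩
    y * Y * W * ((1ℤ - q ^ suc i * q ^ (h ℕ.+ n)) * G) + Y * ((- y) * q ^ suc i * W) * Nb
      ≡⟨ regroup₂ y Y W (q ^ suc i) (q ^ (h ℕ.+ n)) G Nb ⟩
    Y * ((- y) * q ^ suc i * W) * (Nb + q ^ (h ℕ.+ n) * G) + y * (Y * W * G)
      ≡⟨ cong₂ (λ u v → Y * u * v + y * (Y * W * G))
               (sym (signedWeight-suc i)) (sym (qMultinomial-suc q h n i)) ⟩
    coefficient h n (suc i) + y * coefficient h n i ∎
    where
    Y = y ^ h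
    W = signedWeight i
    G = qMultinomial q h n i
    G′ = qMultinomial q (suc h) n i
    Nb = q ^ h * atPred n (λ m → qMultinomial q h m (suc i))
         + atPred h (λ h′ → qMultinomial q h′ n (suc i))
    regroup₁ : ∀ a y Y W G → a * (y * Y * W * G) ≡ y * Y * W * (a * G)
    regroup₁ = solve-∀
    regroup₂ : ∀ y Y W Qi Qhn G Nb → y * Y * W * ((1ℤ - Qi * Qhn) * G) + Y * ((- y) * Qi * W) * Nb
                                     ≡ Y * ((- y) * Qi * W) * (Nb + Qhn * G) + y * (Y * W * G)
    regroup₂ = solve-∀

  coefficient-suc₀ : ∀ h n (t : ℕ → ℤ) →
    neighbours (λ h′ n′ → coefficient h′ n′ 0) h n * atPred (h ℕ.+ n) t
    ≡ coefficient h n 0 * atPred (h ℕ.+ n) t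
  coefficient-suc₀ h n t = begin
    neighbours (λ h′ n′ → coefficient h′ n′ 0) h n * T  ≡⟨ cong (_* T) (neighbours-coefficient h n 0) ⟩
    c * Nb * T                                         ≡⟨ ℤP.*-assoc c Nb T ⟩
    c * (Nb * T)                                       ≡⟨ cong (c *_) (qMultinomial-suc₀ q h n t) ⟩
    c * (qMultinomial q h n 0 * T)                     ≡⟨ sym (ℤP.*-assoc c (qMultinomial q h n 0) T) ⟩
    coefficient h n 0 * T                              ∎
    where
    T = atPred (h ℕ.+ n) t
    c = y ^ h * signedWeight 0
    Nb = q ^ h * atPred n (λ m → qMultinomial q h m 0) + atPred h (λ h′ → qMultinomial q h′ n 0)

  closedSum : ℕ → ℕ → ℕ → ℕ → ℤ
  closedSum L N h n = ∑ L (λ i → coefficient h n i * minorSum y N (h ℕ.+ n ℕ.+ 2 ℕ.* i))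

  closed : ℕ → ℕ → ℕ → ℤ
  closed N = closedSum (suc N) N

  closedSum-length : ∀ {L} N h n → N < L → closedSum L N h n ≡ closed N h n
  closedSum-length N h n N<L = ∑-vanishing-tail (suc N) _ (λ i N<i →
    trans (cong (coefficient h n i *_) (minorSum-vanish-at y N (h ℕ.+ n) i N<i)) (ℤP.*-zeroʳ (coefficient h n i))) N<L

  closed-suc-expand : ∀ N h n →
    closed (suc N) h n ≡ coefficient h n 0 * atPred (h ℕ.+ n) (minorSum y N)
                         + ∑ (suc N) (λ i → coefficient h n (suc i) * minorSum y N (suc (h ℕ.+ n ℕ.+ 2 ℕ.* i)))
                         + (1ℤ + y) * closed N h n
                         + y * ∑ (suc N) (λ i → coefficient h n i * minorSum y N (suc (h ℕ.+ n ℕ.+ 2 ℕ.* i)))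
  closed-suc-expand N h n = begin
    ∑ (suc L) (λ i → D i * minorSum y (suc N) (K i))
      ≡⟨ ∑-cong (suc L) pointwise ⟩
    ∑ (suc L) (λ i → f₁ i + (1ℤ + y) * f₂ i + y * f₃ i)
      ≡⟨ trans (∑-+-* (suc L) y (λ i → f₁ i + (1ℤ + y) * f₂ i) f₃)
               (cong (_+ y * ∑ (suc L) f₃) (∑-+-* (suc L) (1ℤ + y) f₁ f₂)) ⟩
    ∑ (suc L) f₁ + (1ℤ + y) * ∑ (suc L) f₂ + y * ∑ (suc L) f₃
      ≡⟨ cong₂ _+_ (cong₂ _+_ (∑-peel₂ L (h ℕ.+ n) D (λ x → atPred x T))
                              (cong ((1ℤ + y) *_) (closedSum-length N h n (ℕP.m<n⇒m<1+n (ℕP.n<1+n N)))))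
                   (cong (y *_) (∑-vanishing-tail L (suc L) f₃-vanish (ℕP.n≤1+n L))) ⟩
    D 0 * atPred (h ℕ.+ n) T + ∑ L (λ i → D (suc i) * T (suc (K i))) + (1ℤ + y) * closed N h n + y * ∑ L f₃ ∎
    where
    L = suc N
    D = coefficient h n
    T = minorSum y N
    K : ℕ → ℕ
    K i = h ℕ.+ n ℕ.+ 2 ℕ.* i
    f₁ f₂ f₃ : ℕ → ℤ
    f₁ i = D i * atPred (K i) T
    f₂ i = D i * T (K i)
    f₃ i = D i * T (suc (K i))
    distrib : ∀ y d a b c → d * (a + (1ℤ + y) * b + y * c) ≡ d * a + (1ℤ + y) * (d * b) + y * (d * c)
    distrib = solve-∀
    pointwise : ∀ i → D i * minorSum y (suc N) (K i) ≡ f₁ i + (1ℤ + y) * f₂ i + y * f₃ i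
    pointwise i = trans (cong (D i *_) (minorSum-suc y N (K i)))
                        (distrib y (D i) (atPred (K i) T) (T (K i)) (T (suc (K i))))
    f₃-vanish : ∀ i → L ≤ i → f₃ i ≡ 0ℤ
    f₃-vanish i N<i = trans (cong (D i *_) (minorSum-vanish-at y N (suc (h ℕ.+ n)) i N<i)) (ℤP.*-zeroʳ (D i))

  neighbours-closed : ∀ N h n →
    neighbours (closed N) h n
    ≡ neighbours (λ h′ n′ → coefficient h′ n′ 0) h n * atPred (h ℕ.+ n) (minorSum y N)
      + ∑ (suc N) (λ i → neighbours (λ h′ n′ → coefficient h′ n′ (suc i)) h n
                         * minorSum y N (suc (h ℕ.+ n ℕ.+ 2 ℕ.* i)))
  neighbours-closed N h n = begin
    q ^ h * atPred n (closed N h) + y * atPred h (λ h′ → closed N h′ n)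
      ≡⟨ cong₂ (λ u v → q ^ h * u + y * v) (atPred-cong n (λ m → sym (closedSum-length N h m N<L₂)))
                                          (atPred-cong h (λ h′ → sym (closedSum-length N h′ n N<L₂))) ⟩
    q ^ h * atPred n (λ m → closedSum (suc L) N h m) + y * atPred h (λ h′ → closedSum (suc L) N h′ n)
      ≡⟨ cong₂ (λ u v → q ^ h * u + y * v) (atPred-∑-peel₂ L n (h ℕ.+_) (ℕP.+-suc h) (coefficient h) T)
                                          (atPred-∑-peel₂ L h (ℕ._+ n) (λ _ → refl) (λ h′ → coefficient h′ n) T) ⟩
    q ^ h * (a 0 * t + Sa) + y * (b 0 * t + Sb)
      ≡⟨ regroup (q ^ h) y (a 0) (b 0) t Sa Sb ⟩
    (q ^ h * a 0 + y * b 0) * t + (q ^ h * Sa + y * Sb)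
      ≡⟨ cong (_+_ ((q ^ h * a 0 + y * b 0) * t)) (sym combine) ⟩
    (q ^ h * a 0 + y * b 0) * t + ∑ L (λ i → (q ^ h * a (suc i) + y * b (suc i)) * A′ i) ∎
    where
    L = suc N
    N<L₂ : N < suc L
    N<L₂ = ℕP.m<n⇒m<1+n (ℕP.n<1+n N)
    T = minorSum y N
    t = atPred (h ℕ.+ n) T
    A′ : ℕ → ℤ
    A′ i = T (suc (h ℕ.+ n ℕ.+ 2 ℕ.* i))
    a b : ℕ → ℤ
    a j = atPred n (λ m → coefficient h m j)
    b j = atPred h (λ h′ → coefficient h′ n j)
    regroup : ∀ Q y a₀ b₀ t Sa Sb → Q * (a₀ * t + Sa) + y * (b₀ * t + Sb)
                                    ≡ (Q * a₀ + y * b₀) * t + (Q * Sa + y * Sb)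
    regroup = solve-∀
    distrib : ∀ Q y a b c → (Q * a + y * b) * c ≡ Q * (a * c) + y * (b * c)
    distrib = solve-∀
    Sa = ∑ L (λ i → a (suc i) * A′ i)
    Sb = ∑ L (λ i → b (suc i) * A′ i)
    combine : ∑ L (λ i → (q ^ h * a (suc i) + y * b (suc i)) * A′ i) ≡ q ^ h * Sa + y * Sb
    combine = trans (∑-cong L (λ i → distrib (q ^ h) y (a (suc i)) (b (suc i)) (A′ i)))
                    (trans (∑-+ L (λ i → q ^ h * (a (suc i) * A′ i)) (λ i → y * (b (suc i) * A′ i)))
                           (cong₂ _+_ (∑-*ˡ L (q ^ h) (λ i → a (suc i) * A′ i))
                                      (∑-*ˡ L y (λ i → b (suc i) * A′ i))))

  closed-suc : ∀ N h n → closed (suc N) h n ≡ extend (closed N) h n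
  closed-suc N h n = begin
    closed (suc N) h n
      ≡⟨ closed-suc-expand N h n ⟩
    D 0 * t + S₁ + (1ℤ + y) * X + y * S₀
      ≡⟨ regroup₁ (D 0 * t) S₁ X S₀ y ⟩
    D 0 * t + (S₁ + y * S₀) + (1ℤ + y) * X
      ≡⟨ cong₂ (λ u v → u + v + (1ℤ + y) * X) (sym (coefficient-suc₀ h n T)) recurrence ⟩
    Nb 0 * t + (S′ + (1ℤ - q ^ suc h) * closed N (suc h) n) + (1ℤ + y) * X
      ≡⟨ regroup₂ (Nb 0 * t) S′ (1ℤ - q ^ suc h) (closed N (suc h) n) X y ⟩
    (1ℤ - q ^ suc h) * closed N (suc h) n + (1ℤ + y) * X + (Nb 0 * t + S′)
      ≡⟨ cong (_+_ ((1ℤ - q ^ suc h) * closed N (suc h) n + (1ℤ + y) * X)) (sym (neighbours-closed N h n)) ⟩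
    extend (closed N) h n ∎
    where
    L = suc N
    D = coefficient h n
    T = minorSum y N
    t = atPred (h ℕ.+ n) T
    X = closed N h n
    A′ : ℕ → ℤ
    A′ i = T (suc (h ℕ.+ n ℕ.+ 2 ℕ.* i))
    Nb : ℕ → ℤ
    Nb j = neighbours (λ h′ n′ → coefficient h′ n′ j) h n
    f₀ f₁ g : ℕ → ℤ
    f₀ i = D i * A′ i
    f₁ i = D (suc i) * A′ i
    g i = Nb (suc i) * A′ i
    S₀ = ∑ L f₀
    S₁ = ∑ L f₁
    S′ = ∑ L g
    regroup₁ : ∀ a s₁ c s₀ y → a + s₁ + (1ℤ + y) * c + y * s₀ ≡ a + (s₁ + y * s₀) + (1ℤ + y) * c
    regroup₁ = solve-∀
    regroup₂ : ∀ a s e c₁ c y → a + (s + e * c₁) + (1ℤ + y) * c ≡ e * c₁ + (1ℤ + y) * c + (a + s)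
    regroup₂ = solve-∀
    distrib : ∀ u v y w → u * w + y * (v * w) ≡ (u + y * v) * w
    distrib = solve-∀
    distrib′ : ∀ u e v w → (e * v + u) * w ≡ u * w + e * (v * w)
    distrib′ = solve-∀
    pointwise : ∀ i → f₁ i + y * f₀ i ≡ g i + (1ℤ - q ^ suc h) * (coefficient (suc h) n i * A′ i)
    pointwise i = trans (distrib (D (suc i)) (D i) y (A′ i))
      (trans (cong (_* A′ i) (sym (coefficient-suc h n i)))
             (distrib′ (Nb (suc i)) (1ℤ - q ^ suc h) (coefficient (suc h) n i) (A′ i)))
    recurrence : S₁ + y * S₀ ≡ S′ + (1ℤ - q ^ suc h) * closed N (suc h) n
    recurrence = trans (sym (∑-+-* L y f₁ f₀)) (trans (∑-cong L pointwise)
                       (∑-+-* L (1ℤ - q ^ suc h) g (λ i → coefficient (suc h) n i * A′ i)))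

  closed-zero : ∀ h n → 0 < h ℕ.+ n → closed 0 h n ≡ 0ℤ
  closed-zero h n 0<h+n = ∑-zero 1 (λ i →
    trans (cong (coefficient h n i *_) (minorSum-vanish y (ℕP.<-≤-trans 0<h+n (ℕP.m≤m+n _ (2 ℕ.* i)))))
          (ℤP.*-zeroʳ (coefficient h n i)))

  pathSum≡closed : ∀ N h n → pathSum N h n ≡ closed N h n
  pathSum≡closed zero    zero    zero    = refl
  pathSum≡closed zero    zero    (suc n) = sym (closed-zero 0 (suc n) (s≤s z≤n))
  pathSum≡closed zero    (suc h) n       = sym (closed-zero (suc h) n (s≤s z≤n))
  pathSum≡closed (suc N) h n = begin
    pathSum (suc N) h n     ≡⟨ pathSum-suc N h n ⟩
    extend (pathSum N) h n  ≡⟨ extend-cong (pathSum≡closed N) h n ⟩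
    extend (closed N) h n   ≡⟨ sym (closed-suc N h n) ⟩
    closed (suc N) h n      ∎

proposition4p1 : (N n : ℕ) → n ≤ N → (y q : ℤ) → weightSumR N n y q ≡ RNn N n y q
proposition4p1 N n _ y q = begin
  weightSumR N n y q     ≡⟨ pathSum≡closed y q N 0 n ⟩
  ∑ (suc N) term         ≡⟨ ∑-vanishing-tail (suc half) (suc N) beyond-half (s≤s half≤N) ⟩
  ∑ (suc half) term      ≡⟨ ∑-cong (suc half) term≡rnTerm ⟩
  ∑ (suc half) rnTerm    ≡⟨ sym (sumTo≡∑ half rnTerm) ⟩
  RNn N n y q            ∎
  where
  half = (N ∸ n) / 2
  minorTerm : ℕ → ℕ → ℤ
  minorTerm i j = y ^ j * binomialMinor N (n ℕ.+ 2 ℕ.* i) j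
  half≤N : half ≤ N
  half≤N = ℕP.≤-trans (m/n≤m (N ∸ n) 2) (ℕP.m∸n≤m N n)
  term rnTerm : ℕ → ℤ
  term i = coefficient y q 0 n i * minorSum y N (n ℕ.+ 2 ℕ.* i)
  rnTerm i = (- y) ^ i * q ^ (suc i C 2) * gauss q (n ℕ.+ i) i
             * sumTo (N ∸ n ∸ 2 ℕ.* i) (minorTerm i)
  beyond-half : ∀ i → suc half ≤ i → term i ≡ 0ℤ
  beyond-half i half<i =
    trans (cong (coefficient y q 0 n i *_) (minorSum-vanish y N<n+2i)) (ℤP.*-zeroʳ (coefficient y q 0 n i))
    where
    N<n+2i : N < n ℕ.+ 2 ℕ.* i
    N<n+2i = ℕP.≤-<-trans (ℕP.m≤n+m∸n N n) (ℕP.+-monoʳ-< n (m/2<n⇒m<2*n half<i))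
  unit : ∀ w g s → 1ℤ * w * (1ℤ * g) * s ≡ w * g * s
  unit = solve-∀
  term≡rnTerm : ∀ i → term i ≡ rnTerm i
  term≡rnTerm i = trans
    (cong₂ (λ k s → 1ℤ * signedWeight y q i * (1ℤ * gauss q k i) * s) (ℕP.+-comm i n)
      (sym (trans (cong (λ x → sumTo x (minorTerm i)) (ℕP.∸-+-assoc N n (2 ℕ.* i)))
                  (minorSum-sumTo y N (n ℕ.+ 2 ℕ.* i)))))
    (unit (signedWeight y q i) (gauss q (n ℕ.+ i) i) (sumTo (N ∸ n ∸ 2 ℕ.* i) (minorTerm i)))
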